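{- Let $n,r$ be positive integers with $r\geq 2$. If $\chi$ is a palindromic Gallai-Schur $r$-coloring of $[1,n]$, then $\chi^{**}=\langle \chi, r+1,\chi, r+2,\chi, r+2,\chi, r+1,\chi\rangle$ is a palindromic Gallai-Schur $(r+2)$-coloring of $[1,5n+4]$.
   Context: $[1,n]=\{1,\dots,n\}$. An $r$-coloring of $[1,n]$ is a function $\chi:[1,n]\to\{1,\dots,r\}$. Under $\chi$, a Gallai-Schur triple is a triple $(x,y,z)$ with $x,y,z\in[1,n]$, $x\leq y$, $x+y=z$, and either $\chi(x)=\chi(y)=\chi(z)$ or $\chi(x),\chi(y),\chi(z)$ pairwise distinct. $\chi$ is a Gallai-Schur coloring if it has no Gallai-Schur triple, and palindromic if $\chi(i)=\chi(n+1-i)$ for all $i\in[1,n]$. For a coloring $\chi$ of $[1,n]$ and colors $c_1,\dots,c_m$, the concatenation $\langle \chi,c_1,\chi,c_2,\dots,c_m,\chi\rangle$ is the coloring $\psi$ of $[1,(m+1)n+m]$ with $\psi(j(n+1))=c_j$ for $j\in[1,m]$ and $\psi(i+(j-1)(n+1))=\chi(i)$ for $i\in[1,n]$, $j\in[1,m+1]$. -}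

module Defs where

open import Data.Nat using (ℕ; zero; suc; _+_; _*_; _∸_; _≤_; _<_; NonZero)
open import Data.Nat.DivMod using (_/_; _%_)
open import Data.List using (List; []; _∷_; length; lookup)
open import Data.Fin using (Fin)
open import Data.Product using (_×_; ∃)
open import Data.Sum using (_⊎_)
open import Relation.Binary.PropositionalEquality using (_≡_; _≢_)
open import Relation.Nullary using (¬_)

-- A coloring of [1,n] is represented as a function ℕ → ℕ; only values on
-- [1,n] matter. It is an r-coloring if every i ∈ [1,n] gets a color in [1,r].
IsRColoring : ℕ → ℕ → (ℕ → ℕ) → Set
IsRColoring n r χ = ∀ i → 1 ≤ i → i ≤ n → 1 ≤ χ i × χ i ≤ r

GallaiSchurTriple : ℕ → (ℕ → ℕ) → ℕ → ℕ → ℕ → Set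
GallaiSchurTriple n χ x y z =
  1 ≤ x × x ≤ y × z ≤ n × x + y ≡ z ×
  ((χ x ≡ χ y × χ y ≡ χ z) ⊎ (χ x ≢ χ y × χ y ≢ χ z × χ x ≢ χ z))

-- no Gallai-Schur triple (note 1 ≤ x ≤ y and z = x + y ≤ n put all in [1,n])
IsGallaiSchur : ℕ → (ℕ → ℕ) → Set
IsGallaiSchur n χ = ∀ x y z → ¬ GallaiSchurTriple n χ x y z

IsGallaiSchurRColoring : ℕ → ℕ → (ℕ → ℕ) → Set
IsGallaiSchurRColoring n r χ = IsRColoring n r χ × IsGallaiSchur n χ

IsPalindromic : ℕ → (ℕ → ℕ) → Set
IsPalindromic n χ = ∀ i → 1 ≤ i → i ≤ n → χ i ≡ χ (suc n ∸ i)

-- Concatenation ⟨χ,c₁,χ,…,c_m,χ⟩ for a coloring χ of [1,n] and the list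
-- cs = c₁ ∷ … ∷ c_m ∷ [] : a coloring of [1,(m+1)n+m].
-- For k = j(n+1) + i with 1 ≤ i ≤ n it gives χ i; for k = j(n+1), j ∈ [1,m],
-- it gives c_j. (Values outside the range are irrelevant: 0.)
nth : List ℕ → ℕ → ℕ
nth [] _ = 0
nth (c ∷ cs) zero = c
nth (c ∷ cs) (suc j) = nth cs j

concatColoring : ℕ → (ℕ → ℕ) → List ℕ → ℕ → ℕ
concatColoring n χ cs k with k % suc n
... | zero  = nth cs (k / suc n ∸ 1)
... | suc i = χ (suc i)

module Submission where

-- Positions of ⟨χ, c₁, χ, …, c_m, χ⟩ are read modulo n + 1: multiples q(n + 1) carry the separator
-- c_q, the others the colour χ i of their residue i. In a sum x + y = z, two separators give a triple
-- of the separator colouring c₁ … c_m; a separator and a χ-position give two equal χ-colours and a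
-- fresh one; two χ-positions whose residues add to at most n give a χ-triple. If the residues add to
-- n + 1, z is a separator while χ i = χ (n + 1 − i) = χ j by palindromicity; if they exceed it, the
-- same reflection turns the triple into a χ-triple. For ⟨χ, r+1, χ, r+2, χ, r+2, χ, r+1, χ⟩ the
-- separator colouring c d d c of [1,4] has no Gallai-Schur triple as soon as c ≠ d.

open import Defs
open import Data.Nat using (ℕ; zero; suc; _+_; _*_; _∸_; _≤_; _<_; z≤n; s≤s; nonZero)
open import Data.Nat.Properties
open import Data.Nat.DivMod using (_%_; _/_; m≡m%n+[m/n]*n; m%n<n; [m+kn]%n≡m%n; m<n⇒m%n≡m; m*n%n≡0; m*n/n≡m)
open import Data.Nat.Tactic.RingSolver using (solve-∀)
open import Data.List using (List; []; _∷_; length)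
open import Data.Product using (_×_; _,_; proj₂)
open import Data.Sum using (_⊎_; inj₁; inj₂)
open import Relation.Binary.PropositionalEquality
open import Relation.Binary.Definitions using (tri<; tri≈; tri>)
open import Relation.Nullary using (¬_)

MonoOrRainbow : ℕ → ℕ → ℕ → Set
MonoOrRainbow p q s = (p ≡ q × q ≡ s) ⊎ (p ≢ q × q ≢ s × p ≢ s)

module _ {p q s : ℕ} where

  monoOrRainbow-cong : ∀ {p′ q′ s′} → p ≡ p′ → q ≡ q′ → s ≡ s′ →
    MonoOrRainbow p q s → MonoOrRainbow p′ q′ s′
  monoOrRainbow-cong refl refl refl mor = mor

  monoOrRainbow-swap₁₂ : MonoOrRainbow p q s → MonoOrRainbow q p s
  monoOrRainbow-swap₁₂ (inj₁ (p≡q , q≡s)) = inj₁ (sym p≡q , trans p≡q q≡s)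
  monoOrRainbow-swap₁₂ (inj₂ (p≢q , q≢s , p≢s)) = inj₂ (≢-sym p≢q , p≢s , q≢s)

  monoOrRainbow-swap₂₃ : MonoOrRainbow p q s → MonoOrRainbow p s q
  monoOrRainbow-swap₂₃ (inj₁ (p≡q , q≡s)) = inj₁ (trans p≡q q≡s , sym q≡s)
  monoOrRainbow-swap₂₃ (inj₂ (p≢q , q≢s , p≢s)) = inj₂ (p≢s , ≢-sym q≢s , p≢q)

  ¬monoOrRainbow-≡₁₂ : p ≡ q → q ≢ s → ¬ MonoOrRainbow p q s
  ¬monoOrRainbow-≡₁₂ _   q≢s (inj₁ (_ , q≡s)) = q≢s q≡s
  ¬monoOrRainbow-≡₁₂ p≡q _   (inj₂ (p≢q , _)) = p≢q p≡q

  ¬monoOrRainbow-≡₂₃ : q ≡ s → p ≢ q → ¬ MonoOrRainbow p q s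
  ¬monoOrRainbow-≡₂₃ _   p≢q (inj₁ (p≡q , _)) = p≢q p≡q
  ¬monoOrRainbow-≡₂₃ q≡s _   (inj₂ (_ , q≢s , _)) = q≢s q≡s

  ¬monoOrRainbow-≡₁₃ : p ≡ s → p ≢ q → ¬ MonoOrRainbow p q s
  ¬monoOrRainbow-≡₁₃ _   p≢q (inj₁ (p≡q , _)) = p≢q p≡q
  ¬monoOrRainbow-≡₁₃ p≡s _   (inj₂ (_ , _ , p≢s)) = p≢s p≡s

gallaiSchur-¬monoOrRainbow : ∀ {n χ} → IsGallaiSchur n χ → ∀ {u v} → 1 ≤ u → 1 ≤ v → u + v ≤ n →
  ¬ MonoOrRainbow (χ u) (χ v) (χ (u + v))
gallaiSchur-¬monoOrRainbow gs {u} {v} 1≤u 1≤v u+v≤n mor with ≤-total u v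
... | inj₁ u≤v = gs u v (u + v) (1≤u , u≤v , u+v≤n , refl , mor)
... | inj₂ v≤u = gs v u (u + v) (1≤v , v≤u , u+v≤n , +-comm v u , monoOrRainbow-swap₁₂ mor)

IsRColoring-mono : ∀ {n r r′ χ} → r ≤ r′ → IsRColoring n r χ → IsRColoring n r′ χ
IsRColoring-mono r≤r′ col i 1≤i i≤n with col i 1≤i i≤n
... | 1≤χi , χi≤r = 1≤χi , ≤-trans χi≤r r≤r′

DisjointPalettes : ℕ → (ℕ → ℕ) → ℕ → (ℕ → ℕ) → Set
DisjointPalettes n χ m σ = ∀ i q → 1 ≤ i → i ≤ n → 1 ≤ q → q ≤ m → χ i ≢ σ q

disjointPalettes-above : ∀ {n r χ m σ} → IsRColoring n r χ → (∀ q → 1 ≤ q → q ≤ m → r < σ q) →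
  DisjointPalettes n χ m σ
disjointPalettes-above col above i q 1≤i i≤n 1≤q q≤m =
  <⇒≢ (≤-<-trans (proj₂ (col i 1≤i i≤n)) (above q 1≤q q≤m))

separatorColoring : List ℕ → ℕ → ℕ
separatorColoring cs q = nth cs (q ∸ 1)

data Position (n : ℕ) : ℕ → Set where
  separator : ∀ q → Position n (q * suc n)
  interior  : ∀ q {i} → i < n → Position n (suc i + q * suc n)

position : ∀ n k → Position n k
position n k = subst (Position n) (sym (m≡m%n+[m/n]*n k (suc n)))
  (fromResidue (k % suc n) (k / suc n) (m%n<n k (suc n)))
  where
  fromResidue : ∀ i q → i < suc n → Position n (i + q * suc n)
  fromResidue zero    q _         = separator q
  fromResidue (suc i) q (s≤s i<n) = interior q i<n

regroup : ∀ i a j b N → (i + a * N) + (j + b * N) ≡ (i + j) + (a + b) * N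
regroup = solve-∀

regroup-carry : ∀ i a j b N k → i + j ≡ N + k → (i + a * N) + (j + b * N) ≡ k + suc (a + b) * N
regroup-carry i a j b N k i+j≡N+k = begin
  (i + a * N) + (j + b * N) ≡⟨ regroup i a j b N ⟩
  (i + j) + (a + b) * N     ≡⟨ cong (_+ (a + b) * N) i+j≡N+k ⟩
  (N + k) + (a + b) * N     ≡⟨ cong (_+ (a + b) * N) (+-comm N k) ⟩
  (k + N) + (a + b) * N     ≡⟨ +-assoc k N ((a + b) * N) ⟩
  k + suc (a + b) * N       ∎
  where open ≡-Reasoning

suc-concatLength : ∀ m n → suc (suc m * n + m) ≡ suc m * suc n
suc-concatLength = solve-∀

module Concatenation (n : ℕ) (χ : ℕ → ℕ) (cs : List ℕ) where

  private
    N m L : ℕ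
    N = suc n
    m = length cs
    L = suc m * n + m
    σ ψ : ℕ → ℕ
    σ = separatorColoring cs
    ψ = concatColoring n χ cs

  ψ-separator : ∀ q → ψ (q * N) ≡ σ q
  ψ-separator q rewrite m*n%n≡0 q N ⦃ nonZero ⦄ | m*n/n≡m q N ⦃ nonZero ⦄ = refl

  ψ-interior : ∀ q {i} → 1 ≤ i → i ≤ n → ψ (i + q * N) ≡ χ i
  ψ-interior q {suc i} _ i<n rewrite [m+kn]%n≡m%n (suc i) q N ⦃ nonZero ⦄ | m<n⇒m%n≡m (s≤s i<n) = refl

  quotient-≤ : ∀ i q → i + q * N ≤ L → q ≤ m
  quotient-≤ i q k≤L = ≤-pred (*-cancelʳ-< N q (suc m) (begin-strict
    q * N     ≤⟨ m≤n+m (q * N) i ⟩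
    i + q * N ≤⟨ k≤L ⟩
    L         <⟨ ≤-reflexive (suc-concatLength m n) ⟩
    suc m * N ∎))
    where open ≤-Reasoning

  quotient-pos : ∀ q → 1 ≤ q * N → 1 ≤ q
  quotient-pos (suc q) _ = s≤s z≤n

  concat-isRColoring : ∀ {r} → IsRColoring n r χ → IsRColoring m r σ → IsRColoring L r ψ
  concat-isRColoring χ-col σ-col k 1≤k k≤L with position n k
  ... | separator q = subst (λ c → 1 ≤ c × c ≤ _) (sym (ψ-separator q))
                        (σ-col q (quotient-pos q 1≤k) (quotient-≤ 0 q k≤L))
  ... | interior q i<n = subst (λ c → 1 ≤ c × c ≤ _) (sym (ψ-interior q (s≤s z≤n) i<n))
                           (χ-col _ (s≤s z≤n) i<n)

  mirror-separator : ∀ q → suc L ∸ q * N ≡ (suc m ∸ q) * N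
  mirror-separator q = trans (cong (_∸ q * N) (suc-concatLength m n)) (sym (*-distribʳ-∸ N (suc m) q))

  mirror-interior : ∀ q {i} → q ≤ m → i < n → suc L ∸ (suc i + q * N) ≡ (n ∸ i) + (m ∸ q) * N
  mirror-interior q {i} q≤m i<n = trans (cong (_∸ (suc i + q * N)) (sym sum≡)) (m+n∸m≡n (suc i + q * N) _)
    where
    open ≡-Reasoning
    sum≡ : (suc i + q * N) + ((n ∸ i) + (m ∸ q) * N) ≡ suc L
    sum≡ = begin
      (suc i + q * N) + ((n ∸ i) + (m ∸ q) * N) ≡⟨ regroup (suc i) q (n ∸ i) (m ∸ q) N ⟩
      suc (i + (n ∸ i)) + (q + (m ∸ q)) * N     ≡⟨ cong₂ (λ a b → suc a + b * N) (m+[n∸m]≡n (<⇒≤ i<n)) (m+[n∸m]≡n q≤m) ⟩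
      N + m * N                                  ≡⟨ sym (suc-concatLength m n) ⟩
      suc L                                      ∎

  concat-isPalindromic : IsPalindromic n χ → IsPalindromic m σ → IsPalindromic L ψ
  concat-isPalindromic χ-pal σ-pal k 1≤k k≤L with position n k
  ... | separator q = begin
    ψ (q * N)              ≡⟨ ψ-separator q ⟩
    σ q                    ≡⟨ σ-pal q (quotient-pos q 1≤k) q≤m ⟩
    σ (suc m ∸ q)          ≡⟨ ψ-separator (suc m ∸ q) ⟨
    ψ ((suc m ∸ q) * N)    ≡⟨ cong ψ (mirror-separator q) ⟨
    ψ (suc L ∸ q * N)      ∎
    where
    open ≡-Reasoning
    q≤m : q ≤ m
    q≤m = quotient-≤ 0 q k≤L
  ... | interior q {i} i<n = begin
    ψ (suc i + q * N)                ≡⟨ ψ-interior q (s≤s z≤n) i<n ⟩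
    χ (suc i)                        ≡⟨ χ-pal (suc i) (s≤s z≤n) i<n ⟩
    χ (n ∸ i)                        ≡⟨ ψ-interior (m ∸ q) (m<n⇒0<n∸m i<n) (m∸n≤m n i) ⟨
    ψ ((n ∸ i) + (m ∸ q) * N)        ≡⟨ cong ψ (mirror-interior q (quotient-≤ (suc i) q k≤L) i<n) ⟨
    ψ (suc L ∸ (suc i + q * N))      ∎
    where open ≡-Reasoning

  module _ (χ-gs : IsGallaiSchur n χ) (χ-pal : IsPalindromic n χ)
           (σ-gs : IsGallaiSchur m σ) (disjoint : DisjointPalettes n χ m σ) where

    separator+separator : ∀ a b → 1 ≤ a * N → a * N ≤ b * N → a * N + b * N ≤ L →
      ¬ MonoOrRainbow (ψ (a * N)) (ψ (b * N)) (ψ (a * N + b * N))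
    separator+separator a b 1≤x x≤y z≤L mor =
      σ-gs a b (a + b) (quotient-pos a 1≤x , *-cancelʳ-≤ a b N x≤y ,
        quotient-≤ 0 (a + b) (subst (_≤ L) z≡ z≤L) , refl ,
        monoOrRainbow-cong (ψ-separator a) (ψ-separator b) (trans (cong ψ z≡) (ψ-separator (a + b))) mor)
      where
      z≡ : a * N + b * N ≡ (a + b) * N
      z≡ = sym (*-distribʳ-+ N a b)

    separator+interior : ∀ a b {j} → j < n → 1 ≤ a * N → a * N + (suc j + b * N) ≤ L →
      ¬ MonoOrRainbow (ψ (a * N)) (ψ (suc j + b * N)) (ψ (a * N + (suc j + b * N)))
    separator+interior a b {j} j<n 1≤x z≤L mor =
      ¬monoOrRainbow-≡₂₃ refl (≢-sym (disjoint (suc j) a (s≤s z≤n) j<n (quotient-pos a 1≤x) a≤m))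
        (monoOrRainbow-cong (ψ-separator a) (ψ-interior b (s≤s z≤n) j<n)
          (trans (cong ψ z≡) (ψ-interior (a + b) (s≤s z≤n) j<n)) mor)
      where
      z≡ : a * N + (suc j + b * N) ≡ suc j + (a + b) * N
      z≡ = regroup 0 a (suc j) b N
      a≤m : a ≤ m
      a≤m = ≤-trans (m≤m+n a b) (quotient-≤ (suc j) (a + b) (subst (_≤ L) z≡ z≤L))

    interior+separator : ∀ a b {i} → i < n → suc i + a * N ≤ b * N → (suc i + a * N) + b * N ≤ L →
      ¬ MonoOrRainbow (ψ (suc i + a * N)) (ψ (b * N)) (ψ ((suc i + a * N) + b * N))
    interior+separator a b {i} i<n x≤y z≤L mor =
      ¬monoOrRainbow-≡₁₃ refl (disjoint (suc i) b (s≤s z≤n) i<n (quotient-pos b (≤-trans (s≤s z≤n) x≤y)) b≤m)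
        (monoOrRainbow-cong (ψ-interior a (s≤s z≤n) i<n) (ψ-separator b)
          (trans (cong ψ z≡) (ψ-interior (a + b) (s≤s z≤n) i<n)) mor)
      where
      z≡ : (suc i + a * N) + b * N ≡ suc i + (a + b) * N
      z≡ = trans (regroup (suc i) a 0 b N) (cong (_+ (a + b) * N) (+-identityʳ (suc i)))
      b≤m : b ≤ m
      b≤m = ≤-trans (m≤n+m b a) (quotient-≤ (suc i) (a + b) (subst (_≤ L) z≡ z≤L))

    interior+interior-noCarry : ∀ a b {i j} → i < n → j < n → suc i + suc j < N →
      ¬ MonoOrRainbow (ψ (suc i + a * N)) (ψ (suc j + b * N)) (ψ ((suc i + a * N) + (suc j + b * N)))
    interior+interior-noCarry a b {i} {j} i<n j<n i+j<N mor =
      gallaiSchur-¬monoOrRainbow χ-gs (s≤s z≤n) (s≤s z≤n) (≤-pred i+j<N)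
        (monoOrRainbow-cong (ψ-interior a (s≤s z≤n) i<n) (ψ-interior b (s≤s z≤n) j<n)
          (trans (cong ψ (regroup (suc i) a (suc j) b N)) (ψ-interior (a + b) (s≤s z≤n) (≤-pred i+j<N))) mor)

    interior+interior-exactCarry : ∀ a b {i j} → i < n → j < n → suc i + suc j ≡ N →
      (suc i + a * N) + (suc j + b * N) ≤ L →
      ¬ MonoOrRainbow (ψ (suc i + a * N)) (ψ (suc j + b * N)) (ψ ((suc i + a * N) + (suc j + b * N)))
    interior+interior-exactCarry a b {i} {j} i<n j<n i+j≡N z≤L mor =
      ¬monoOrRainbow-≡₁₂ χi≡χj (disjoint (suc j) (suc (a + b)) (s≤s z≤n) j<n (s≤s z≤n) a+b<m)
        (monoOrRainbow-cong (ψ-interior a (s≤s z≤n) i<n) (ψ-interior b (s≤s z≤n) j<n)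
          (trans (cong ψ z≡) (ψ-separator (suc (a + b)))) mor)
      where
      z≡ : (suc i + a * N) + (suc j + b * N) ≡ suc (a + b) * N
      z≡ = regroup-carry (suc i) a (suc j) b N 0 (trans i+j≡N (sym (+-identityʳ N)))
      a+b<m : suc (a + b) ≤ m
      a+b<m = quotient-≤ 0 (suc (a + b)) (subst (_≤ L) z≡ z≤L)
      χi≡χj : χ (suc i) ≡ χ (suc j)
      χi≡χj = trans (χ-pal (suc i) (s≤s z≤n) i<n)
                (cong χ (trans (cong (_∸ i) (sym (suc-injective i+j≡N))) (m+n∸m≡n i (suc j))))

    -- The residues i′ = suc i, j′ = suc j carry into the residue o′ = suc o of x + y. With
    -- u = n + 1 − i′ we have u + o′ = j′ and χ u = χ i′, so the colours (χ i′, χ j′, χ o′)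
    -- of the triple under ψ are those of the χ-triple (u, o′, j′).
    interior+interior-carry : ∀ a b {i j} o → i < n → j < n → suc i + suc j ≡ N + suc o →
      ¬ MonoOrRainbow (ψ (suc i + a * N)) (ψ (suc j + b * N)) (ψ ((suc i + a * N) + (suc j + b * N)))
    interior+interior-carry a b {i} {j} o i<n j<n i+j≡N+o mor =
      gallaiSchur-¬monoOrRainbow χ-gs (m<n⇒0<n∸m i<n) (s≤s z≤n) (subst (_≤ n) (sym u+o≡j) j<n)
        (monoOrRainbow-cong χi≡χu refl (cong χ (sym u+o≡j)) (monoOrRainbow-swap₂₃
          (monoOrRainbow-cong (ψ-interior a (s≤s z≤n) i<n) (ψ-interior b (s≤s z≤n) j<n)
            (trans (cong ψ (regroup-carry (suc i) a (suc j) b N (suc o) i+j≡N+o))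
              (ψ-interior (suc (a + b)) (s≤s z≤n) o<n)) mor)))
      where
      open ≡-Reasoning
      u+o≡j : (n ∸ i) + suc o ≡ suc j
      u+o≡j = +-cancelˡ-≡ (suc i) _ _ (begin
        suc i + ((n ∸ i) + suc o) ≡⟨ +-assoc (suc i) (n ∸ i) (suc o) ⟨
        suc (i + (n ∸ i)) + suc o ≡⟨ cong (λ t → suc t + suc o) (m+[n∸m]≡n (<⇒≤ i<n)) ⟩
        N + suc o                 ≡⟨ i+j≡N+o ⟨
        suc i + suc j             ∎)
      o<n : o < n
      o<n = ≤-trans (subst (suc o ≤_) u+o≡j (m≤n+m (suc o) (n ∸ i))) j<n
      χi≡χu : χ (suc i) ≡ χ (n ∸ i)
      χi≡χu = χ-pal (suc i) (s≤s z≤n) i<n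

    interior+interior : ∀ a b {i j} → i < n → j < n → (suc i + a * N) + (suc j + b * N) ≤ L →
      ¬ MonoOrRainbow (ψ (suc i + a * N)) (ψ (suc j + b * N)) (ψ ((suc i + a * N) + (suc j + b * N)))
    interior+interior a b {i} {j} i<n j<n z≤L with <-cmp (suc i + suc j) N
    ... | tri< i+j<N _ _ = interior+interior-noCarry a b i<n j<n i+j<N
    ... | tri≈ _ i+j≡N _ = interior+interior-exactCarry a b i<n j<n i+j≡N z≤L
    ... | tri> _ _ N<i+j with m≤n⇒∃[o]m+o≡n N<i+j
    ...   | o , N+1+o≡i+j = interior+interior-carry a b o i<n j<n (trans (sym N+1+o≡i+j) (sym (+-suc N o)))

    concat-isGallaiSchur : IsGallaiSchur L ψ
    concat-isGallaiSchur x y _ (1≤x , x≤y , z≤L , refl , mor) with position n x | position n y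
    ... | separator a    | separator b    = separator+separator a b 1≤x x≤y z≤L mor
    ... | separator a    | interior b j<n = separator+interior a b j<n 1≤x z≤L mor
    ... | interior a i<n | separator b    = interior+separator a b i<n x≤y z≤L mor
    ... | interior a i<n | interior b j<n = interior+interior a b i<n j<n z≤L mor

cddc : ℕ → ℕ → List ℕ
cddc c d = c ∷ d ∷ d ∷ c ∷ []

module _ {c d : ℕ} where

  private
    σ : ℕ → ℕ
    σ = separatorColoring (cddc c d)

  cddc-all : (P : ℕ → Set) → P c → P d → ∀ q → 1 ≤ q → q ≤ 4 → P (σ q)
  cddc-all P Pc Pd 1 _ _ = Pc
  cddc-all P Pc Pd 2 _ _ = Pd
  cddc-all P Pc Pd 3 _ _ = Pd
  cddc-all P Pc Pd 4 _ _ = Pc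
  cddc-all P Pc Pd (suc (suc (suc (suc (suc _))))) _ (s≤s (s≤s (s≤s (s≤s ()))))

  cddc-isPalindromic : IsPalindromic 4 σ
  cddc-isPalindromic 1 _ _ = refl
  cddc-isPalindromic 2 _ _ = refl
  cddc-isPalindromic 3 _ _ = refl
  cddc-isPalindromic 4 _ _ = refl
  cddc-isPalindromic (suc (suc (suc (suc (suc _))))) _ (s≤s (s≤s (s≤s (s≤s ()))))

  cddc-isGallaiSchur : c ≢ d → IsGallaiSchur 4 σ
  cddc-isGallaiSchur c≢d 1 1 _ (_ , _ , _ , refl , mor) = ¬monoOrRainbow-≡₁₂ refl c≢d mor
  cddc-isGallaiSchur c≢d 1 2 _ (_ , _ , _ , refl , mor) = ¬monoOrRainbow-≡₂₃ refl c≢d mor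
  cddc-isGallaiSchur c≢d 1 3 _ (_ , _ , _ , refl , mor) = ¬monoOrRainbow-≡₁₃ refl c≢d mor
  cddc-isGallaiSchur c≢d 2 2 _ (_ , _ , _ , refl , mor) = ¬monoOrRainbow-≡₁₂ refl (≢-sym c≢d) mor
  cddc-isGallaiSchur c≢d 1 (suc (suc (suc (suc _)))) _ (_ , _ , s≤s (s≤s (s≤s (s≤s ()))) , refl , _)
  cddc-isGallaiSchur c≢d 2 1 _ (_ , s≤s () , _)
  cddc-isGallaiSchur c≢d 2 (suc (suc (suc _))) _ (_ , _ , s≤s (s≤s (s≤s (s≤s ()))) , refl , _)
  cddc-isGallaiSchur c≢d (suc (suc (suc x))) y _ (_ , x≤y , x+y≤4 , refl , _) = ¬3≤1 (begin
    3     ≤⟨ ≤-trans (s≤s (s≤s (s≤s z≤n))) x≤y ⟩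
    y     ≤⟨ m≤n+m y x ⟩
    x + y ≤⟨ ≤-pred (≤-pred (≤-pred x+y≤4)) ⟩
    1     ∎)
    where
    open ≤-Reasoning
    ¬3≤1 : ¬ 3 ≤ 1
    ¬3≤1 (s≤s ())

lemma2p2 : (n r : ℕ) → 1 ≤ n → 2 ≤ r → (χ : ℕ → ℕ) →
    IsGallaiSchurRColoring n r χ → IsPalindromic n χ →
    IsGallaiSchurRColoring (5 * n + 4) (r + 2)
      (concatColoring n χ (r + 1 ∷ r + 2 ∷ r + 2 ∷ r + 1 ∷ []))
    × IsPalindromic (5 * n + 4)
      (concatColoring n χ (r + 1 ∷ r + 2 ∷ r + 2 ∷ r + 1 ∷ []))
lemma2p2 n r _ _ χ (χ-col , χ-gs) χ-pal =
  ( concat-isRColoring (IsRColoring-mono (m≤m+n r 2) χ-col) σ-col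
  , concat-isGallaiSchur χ-gs χ-pal (cddc-isGallaiSchur r+1≢r+2)
      (disjointPalettes-above χ-col (cddc-all (r <_) (m<m+n r (s≤s z≤n)) (m<m+n r (s≤s z≤n)))) )
  , concat-isPalindromic χ-pal cddc-isPalindromic
  where
  open Concatenation n χ (cddc (r + 1) (r + 2))
  r+1≢r+2 : r + 1 ≢ r + 2
  r+1≢r+2 = <⇒≢ (+-monoʳ-< r (n<1+n 1))
  σ-col : IsRColoring 4 (r + 2) (separatorColoring (cddc (r + 1) (r + 2)))
  σ-col = cddc-all (λ c → 1 ≤ c × c ≤ r + 2) (m≤n+m 1 r , +-monoʳ-≤ r (s≤s z≤n)) (≤-trans (s≤s z≤n) (m≤n+m 2 r) , ≤-refl)
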